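{- For any finite simple graphs $G$ and $H$, (i) $\gamma_R(G\Box H)\ge \frac{2\gamma(G)\gamma_R(H)}{3}$, and (ii) $\gamma_R(G\Box H)\ge \frac{\gamma(G)\gamma_R(H)+\gamma(G\Box H)}{2}$.
   Context: $\gamma(X)$ denotes the domination number of a graph $X$ (minimum size of a set $D$ such that every vertex outside $D$ has a neighbor in $D$). A Roman dominating function on $X$ is a map $f:V(X)\to\{0,1,2\}$ such that every vertex $v$ with $f(v)=0$ has a neighbor $u$ with $f(u)=2$; $\gamma_R(X)$ is the minimum of $\sum_v f(v)$ over such $f$. The Cartesian product $G\Box H$ has vertex set $V(G)\times V(H)$, with $(g,h)\sim(g',h')$ iff ($g=g'$ and $h\sim h'$) or ($g\sim g'$ and $h=h'$). -}

module Defs where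

open import Data.Nat using (ℕ; zero; suc; _+_; _*_; _≤_)
open import Data.Fin using (Fin; zero; suc; toℕ; remQuot; _≟_)
open import Data.Bool using (Bool; true; false)
open import Data.Product using (Σ; _×_; _,_; ∃; proj₁; proj₂)
open import Data.Sum using (_⊎_; inj₁; inj₂)
open import Relation.Binary.PropositionalEquality using (_≡_)
import Relation.Binary.PropositionalEquality as ≡
open import Relation.Nullary.Decidable using (_×-dec_; _⊎-dec_)
open import Relation.Nullary using (¬_; Dec)

record Graph : Set₁ where
  field
    n      : ℕ
    Adj    : Fin n → Fin n → Set
    adj?   : ∀ u v → Dec (Adj u v)
    irrefl : ∀ v → ¬ Adj v v
    sym    : ∀ {u v} → Adj u v → Adj v u

open Graph public

sumFin : ∀ {n} → (Fin n → ℕ) → ℕ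
sumFin {zero}  f = 0
sumFin {suc n} f = f zero + sumFin (λ i → f (suc i))

bit : Bool → ℕ
bit true  = 1
bit false = 0

VSet : Graph → Set
VSet G = Fin (n G) → Bool

size : (G : Graph) → VSet G → ℕ
size G D = sumFin (λ v → bit (D v))

IsDominating : (G : Graph) → VSet G → Set
IsDominating G D = ∀ v → D v ≡ false → ∃ λ u → Adj G v u × D u ≡ true

IsDominationNumber : Graph → ℕ → Set
IsDominationNumber G k =
  (Σ (VSet G) λ D → IsDominating G D × size G D ≡ k) ×
  (∀ D → IsDominating G D → k ≤ size G D)

IsRDF : (G : Graph) → (Fin (n G) → Fin 3) → Set
IsRDF G f = ∀ v → f v ≡ zero → ∃ λ u → Adj G v u × f u ≡ suc (suc zero)

weight : (G : Graph) → (Fin (n G) → Fin 3) → ℕ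
weight G f = sumFin (λ v → toℕ (f v))

IsRomanDominationNumber : Graph → ℕ → Set
IsRomanDominationNumber G k =
  (Σ (Fin (n G) → Fin 3) λ f → IsRDF G f × weight G f ≡ k) ×
  (∀ f → IsRDF G f → k ≤ weight G f)

-- Cartesian product G □ H on Fin (n G * n H), vertex k ↔ remQuot k = (g , h)
ProdAdj : (G H : Graph) → Fin (n G) × Fin (n H) → Fin (n G) × Fin (n H) → Set
ProdAdj G H (g , h) (g' , h') = (g ≡ g' × Adj H h h') ⊎ (Adj G g g' × h ≡ h')


private
  prodAdj? : (G H : Graph) → ∀ x y → Dec (ProdAdj G H x y)
  prodAdj? G H (g , h) (g' , h') =
    ((g ≟ g') ×-dec adj? H h h') ⊎-dec (adj? G g g' ×-dec (h ≟ h'))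

  prodIrrefl : (G H : Graph) → ∀ x → ¬ ProdAdj G H x x
  prodIrrefl G H (g , h) (inj₁ (_ , a)) = irrefl H h a
  prodIrrefl G H (g , h) (inj₂ (a , _)) = irrefl G g a

  prodSym : (G H : Graph) → ∀ {x y} → ProdAdj G H x y → ProdAdj G H y x
  prodSym G H {g , h} {g' , h'} (inj₁ (e , a)) = inj₁ (≡.sym e , sym H a)
  prodSym G H {g , h} {g' , h'} (inj₂ (a , e)) = inj₂ (sym G a , ≡.sym e)

_□_ : Graph → Graph → Graph
G □ H = record
  { n      = n G * n H
  ; Adj    = λ u v → ProdAdj G H (remQuot (n H) u) (remQuot (n H) v)
  ; adj?   = λ u v → prodAdj? G H (remQuot (n H) u) (remQuot (n H) v)
  ; irrefl = λ v → prodIrrefl G H (remQuot (n H) v)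
  ; sym    = prodSym G H
  }

-- Fix a minimum dominating set D of G and a minimum Roman dominating function f of G □ H, and
-- assign every vertex g of G a vertex σ g ∈ D dominating it; the fibres of σ are the cells of D.
-- For u ∈ D, let f_u(h) be the largest value of f on the cell of u in the layer G × {h}, raised
-- from 0 to 1 when the layer is bad for u, i.e. every vertex of the cell has a G-neighbour
-- carrying 2 in that layer. Then f_u is a Roman dominating function of H: where f_u vanishes, the
-- cell has a vertex of value 0 without a 2 among its G-neighbours, so its 2 lies in its H-fibre,
-- where f_u is 2. The weight of f_u is at most the mass of f on the cell plus the number of bad
-- layers. Within one layer, D with its bad vertices exchanged for the 2s of the layer still
-- dominates G, so by minimality there are no more bad vertices of D than 2s. Summing over u ∈ D
-- gives γ(G) γ_R(H) ≤ w(f) + |V₂|, and both bounds follow from w(f) = |V₁ ∪ V₂| + |V₂|,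
-- |V₂| ≤ |V₁ ∪ V₂| and γ(G □ H) ≤ |V₁ ∪ V₂|.

module Submission where

open import Defs hiding (sym)
open import Data.Nat using (ℕ; zero; suc; _+_; _*_; _≤_; z≤n; s≤s)
open import Data.Nat.Properties
  using (+-*-semiring; +-assoc; +-identityʳ; *-identityˡ; ≤-reflexive; ≤-trans; m≤m+n; m≤n+m;
         +-mono-≤; +-monoˡ-≤; +-monoʳ-≤; *-monoʳ-≤; +-cancelˡ-≤; module ≤-Reasoning)
open import Data.Nat.Tactic.RingSolver using (solve)
open import Data.List using (_∷_; [])
open import Data.Fin using (Fin; zero; suc; toℕ; combine; remQuot; _↑ˡ_; _↑ʳ_; _≟_)
open import Data.Fin.Patterns using (0F; 1F; 2F)
open import Data.Fin.Properties using (remQuot-combine; combine-remQuot; any?; all?; ¬∀⟶∃¬)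
open import Data.Bool using (Bool; true; false; _∧_; _∨_; not)
open import Data.Bool.Properties using (∨-zeroʳ; ¬-not) renaming (_≟_ to _≟ᵇ_)
open import Data.Product using (_×_; _,_; ∃; proj₁; proj₂)
open import Data.Sum using (_⊎_; inj₁; inj₂)
open import Function using (_∘_)
open import Relation.Nullary using (¬_; Dec; yes; no; does; contradiction)
open import Relation.Nullary.Decidable using (_×-dec_; _⊎-dec_; _→-dec_; dec-true; dec-false)
open import Relation.Binary.PropositionalEquality
open import Algebra.Properties.Semiring.Sum +-*-semiring
  using (sum; sum-syntax; sum-replicate-zero; sum-cong-≗; ∑-distrib-+; ∑-comm; sum-remove; *-distribˡ-sum; *-distribʳ-sum)

sumFin≡sum : ∀ {m} (x : Fin m → ℕ) → sumFin x ≡ sum x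
sumFin≡sum {zero}  x = refl
sumFin≡sum {suc m} x = cong (x zero +_) (sumFin≡sum (x ∘ suc))

∑-mono-≤ : ∀ {m} {x y : Fin m → ℕ} → (∀ i → x i ≤ y i) → sum x ≤ sum y
∑-mono-≤ {zero}  x≤y = z≤n
∑-mono-≤ {suc m} x≤y = +-mono-≤ (x≤y zero) (∑-mono-≤ (x≤y ∘ suc))

term≤∑ : ∀ {m} (x : Fin m → ℕ) i → x i ≤ sum x
term≤∑ {suc m} x i = ≤-trans (m≤m+n (x i) _) (≤-reflexive (sym (sum-remove {i = i} x)))

∑-↑ : ∀ m k (x : Fin (m + k) → ℕ) → sum x ≡ sum (x ∘ (_↑ˡ k)) + sum (x ∘ (m ↑ʳ_))
∑-↑ zero    k x = refl
∑-↑ (suc m) k x = trans (cong (x zero +_) (∑-↑ m k (x ∘ suc))) (sym (+-assoc (x zero) _ _))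

∑-combine : ∀ m k (x : Fin (m * k) → ℕ) → sum x ≡ ∑[ i < m ] ∑[ j < k ] x (combine i j)
∑-combine zero    k x = refl
∑-combine (suc m) k x =
  trans (∑-↑ k (m * k) x) (cong (sum (x ∘ (_↑ˡ m * k)) +_) (∑-combine m k (x ∘ (k ↑ʳ_))))

∑-indicator : ∀ {m} (i : Fin m) (c : ℕ) → ∑[ j < m ] (bit (does (i ≟ j)) * c) ≡ c
∑-indicator {suc m} zero    c = trans (cong₂ _+_ (*-identityˡ c) (sum-replicate-zero m)) (+-identityʳ c)
∑-indicator {suc m} (suc i) c = ∑-indicator i c

∑-fibres : ∀ {m k} (σ : Fin m → Fin k) (x : Fin m → ℕ) →
           ∑[ u < k ] ∑[ g < m ] (bit (does (σ g ≟ u)) * x g) ≡ sum x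
∑-fibres {m} {k} σ x = begin
  ∑[ u < k ] ∑[ g < m ] (bit (does (σ g ≟ u)) * x g) ≡⟨ ∑-comm (λ u g → bit (does (σ g ≟ u)) * x g) ⟩
  ∑[ g < m ] ∑[ u < k ] (bit (does (σ g ≟ u)) * x g) ≡⟨ sum-cong-≗ (λ g → ∑-indicator (σ g) (x g)) ⟩
  sum x                                              ∎
  where open ≡-Reasoning

size-∨ : ∀ G (A B : VSet G) → size G (λ v → A v ∨ B v) ≤ size G A + size G B
size-∨ G A B = begin
  size G (λ v → A v ∨ B v)             ≡⟨ sumFin≡sum (λ v → bit (A v ∨ B v)) ⟩
  ∑[ v < n G ] bit (A v ∨ B v)         ≤⟨ ∑-mono-≤ (λ v → bit-∨ (A v) (B v)) ⟩
  ∑[ v < n G ] (bit (A v) + bit (B v)) ≡⟨ ∑-distrib-+ (bit ∘ A) (bit ∘ B) ⟩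
  sum (bit ∘ A) + sum (bit ∘ B)        ≡⟨ sym (cong₂ _+_ (sumFin≡sum (bit ∘ A)) (sumFin≡sum (bit ∘ B))) ⟩
  size G A + size G B                  ∎
  where
  open ≤-Reasoning
  bit-∨ : ∀ a b → bit (a ∨ b) ≤ bit a + bit b
  bit-∨ true  b     = s≤s z≤n
  bit-∨ false true  = s≤s z≤n
  bit-∨ false false = z≤n

size-split : ∀ G (A B : VSet G) → size G A ≡ size G (λ v → A v ∧ not (B v)) + size G (λ v → A v ∧ B v)
size-split G A B = begin
  size G A                                              ≡⟨ sumFin≡sum (bit ∘ A) ⟩
  sum (bit ∘ A)                                         ≡⟨ sum-cong-≗ (λ v → bit-split (A v) (B v)) ⟩
  ∑[ v < n G ] (bit (A v ∧ not (B v)) + bit (A v ∧ B v))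
    ≡⟨ ∑-distrib-+ (λ v → bit (A v ∧ not (B v))) (λ v → bit (A v ∧ B v)) ⟩
  sum (λ v → bit (A v ∧ not (B v))) + sum (λ v → bit (A v ∧ B v))
    ≡⟨ sym (cong₂ _+_ (sumFin≡sum (λ v → bit (A v ∧ not (B v)))) (sumFin≡sum (λ v → bit (A v ∧ B v)))) ⟩
  size G (λ v → A v ∧ not (B v)) + size G (λ v → A v ∧ B v) ∎
  where
  open ≡-Reasoning
  bit-split : ∀ a b → bit a ≡ bit (a ∧ not b) + bit (a ∧ b)
  bit-split true  true  = refl
  bit-split true  false = refl
  bit-split false b     = refl

dominator : ∀ {G D} → IsDominating G D → ∀ v → ∃ λ u → D u ≡ true × (v ≡ u ⊎ Adj G v u)
dominator {D = D} D-dom v with D v in v∈D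
... | true  = v , v∈D , inj₁ refl
... | false = let (u , v∼u , u∈D) = D-dom v v∈D in u , u∈D , inj₂ v∼u

minimum-dominating-exchange :
  ∀ G {D} → (∀ D′ → IsDominating G D′ → size G D ≤ size G D′) →
  (B S : VSet G) → IsDominating G (λ v → (D v ∧ not (B v)) ∨ S v) →
  size G (λ v → D v ∧ B v) ≤ size G S
minimum-dominating-exchange G {D} D-min B S D′-dom = +-cancelˡ-≤ (size G D∖B) _ _ (begin
  size G D∖B + size G (λ v → D v ∧ B v) ≡⟨ sym (size-split G D B) ⟩
  size G D                               ≤⟨ D-min _ D′-dom ⟩
  size G (λ v → D∖B v ∨ S v)             ≤⟨ size-∨ G D∖B S ⟩
  size G D∖B + size G S                  ∎)
  where
  open ≤-Reasoning
  D∖B : VSet G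
  D∖B v = D v ∧ not (B v)

isPositive isTwo : Fin 3 → Bool
isPositive 0F = false
isPositive _  = true
isTwo 2F = true
isTwo _  = false

toℕ≡isPositive+isTwo : ∀ x → toℕ x ≡ bit (isPositive x) + bit (isTwo x)
toℕ≡isPositive+isTwo 0F = refl
toℕ≡isPositive+isTwo 1F = refl
toℕ≡isPositive+isTwo 2F = refl

isTwo≤isPositive : ∀ x → bit (isTwo x) ≤ bit (isPositive x)
isTwo≤isPositive 0F = z≤n
isTwo≤isPositive 1F = z≤n
isTwo≤isPositive 2F = s≤s z≤n

isPositive≡false⇒0F : ∀ {x} → isPositive x ≡ false → x ≡ 0F
isPositive≡false⇒0F {0F} _ = refl

isPositive≡true⇒1≤toℕ : ∀ {x} → isPositive x ≡ true → 1 ≤ toℕ x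
isPositive≡true⇒1≤toℕ {1F} _ = s≤s z≤n
isPositive≡true⇒1≤toℕ {2F} _ = s≤s z≤n

isTwo≡true⇒2F : ∀ {x} → isTwo x ≡ true → x ≡ 2F
isTwo≡true⇒2F {2F} _ = refl

V₁₂ V₂ : ∀ {m} → (Fin m → Fin 3) → Fin m → Bool
V₁₂ f = isPositive ∘ f
V₂  f = isTwo ∘ f

weight≡|V₁₂|+|V₂| : ∀ G f → weight G f ≡ size G (V₁₂ f) + size G (V₂ f)
weight≡|V₁₂|+|V₂| G f = begin
  weight G f
    ≡⟨ sumFin≡sum (toℕ ∘ f) ⟩
  ∑[ v < n G ] toℕ (f v)
    ≡⟨ sum-cong-≗ (toℕ≡isPositive+isTwo ∘ f) ⟩
  ∑[ v < n G ] (bit (V₁₂ f v) + bit (V₂ f v))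
    ≡⟨ ∑-distrib-+ (bit ∘ V₁₂ f) (bit ∘ V₂ f) ⟩
  sum (bit ∘ V₁₂ f) + sum (bit ∘ V₂ f)
    ≡⟨ sym (cong₂ _+_ (sumFin≡sum (bit ∘ V₁₂ f)) (sumFin≡sum (bit ∘ V₂ f))) ⟩
  size G (V₁₂ f) + size G (V₂ f) ∎
  where open ≡-Reasoning

|V₂|≤|V₁₂| : ∀ G f → size G (V₂ f) ≤ size G (V₁₂ f)
|V₂|≤|V₁₂| G f = begin
  size G (V₂ f)     ≡⟨ sumFin≡sum (bit ∘ V₂ f) ⟩
  sum (bit ∘ V₂ f)  ≤⟨ ∑-mono-≤ (isTwo≤isPositive ∘ f) ⟩
  sum (bit ∘ V₁₂ f) ≡⟨ sym (sumFin≡sum (bit ∘ V₁₂ f)) ⟩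
  size G (V₁₂ f)    ∎
  where open ≤-Reasoning

V₁₂-dominating : ∀ {G f} → IsRDF G f → IsDominating G (V₁₂ f)
V₁₂-dominating f-rdf v v∉V₁₂ =
  let (u , v∼u , fu≡2) = f-rdf v (isPositive≡false⇒0F v∉V₁₂) in u , v∼u , cong isPositive fu≡2

□-adjacent : ∀ {G H} g h k → Adj (G □ H) (combine g h) k →
             (∃ λ h′ → Adj H h h′ × k ≡ combine g h′) ⊎ (∃ λ g′ → Adj G g g′ × k ≡ combine g′ h)
□-adjacent {G} {H} g h k gh∼k =
  neighbour (subst (λ x → ProdAdj G H x (remQuot (n H) k)) (remQuot-combine g h) gh∼k)
            (sym (combine-remQuot {n G} (n H) k))
  where
  neighbour : ∀ {g′ h′} → ProdAdj G H (g , h) (g′ , h′) → k ≡ combine g′ h′ →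
              (∃ λ h′ → Adj H h h′ × k ≡ combine g h′) ⊎ (∃ λ g′ → Adj G g g′ × k ≡ combine g′ h)
  neighbour (inj₁ (refl , h∼h′)) k≡ = inj₁ (_ , h∼h′ , k≡)
  neighbour (inj₂ (g∼g′ , refl)) k≡ = inj₂ (_ , g∼g′ , k≡)

module CellProjection
  (G H : Graph) {f : Fin (n G * n H) → Fin 3} (f-rdf : IsRDF (G □ H) f)
  {D : VSet G} (D-dom : IsDominating G D) where

  φ : Fin (n G) → Fin (n H) → Fin 3
  φ g h = f (combine g h)

  φ-rdf : ∀ g h → φ g h ≡ 0F →
          (∃ λ h′ → Adj H h h′ × φ g h′ ≡ 2F) ⊎ (∃ λ g′ → Adj G g g′ × φ g′ h ≡ 2F)
  φ-rdf g h φ≡0 with f-rdf (combine {n G} {n H} g h) φ≡0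
  ... | k , gh∼k , fk≡2 with □-adjacent {G} {H} g h k gh∼k
  ...   | inj₁ (h′ , h∼h′ , refl) = inj₁ (h′ , h∼h′ , fk≡2)
  ...   | inj₂ (g′ , g∼g′ , refl) = inj₂ (g′ , g∼g′ , fk≡2)

  σ : Fin (n G) → Fin (n G)
  σ v = proj₁ (dominator {G} D-dom v)

  σ∈D : ∀ v → D (σ v) ≡ true
  σ∈D v = proj₁ (proj₂ (dominator {G} D-dom v))

  InCell : (Fin 3 → Bool) → Fin (n G) → Fin (n H) → Set
  InCell t u h = ∃ λ g → σ g ≡ u × t (φ g h) ≡ true

  inCell? : ∀ t u h → Dec (InCell t u h)
  inCell? t u h = any? (λ g → (σ g ≟ u) ×-dec (t (φ g h) ≟ᵇ true))

  Covered : Fin (n H) → Fin (n G) → Set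
  Covered h g = ∃ λ g′ → Adj G g g′ × φ g′ h ≡ 2F

  covered? : ∀ h g → Dec (Covered h g)
  covered? h g = any? (λ g′ → adj? G g g′ ×-dec (φ g′ h ≟ 2F))

  Bad : Fin (n G) → Fin (n H) → Set
  Bad u h = ∀ g → σ g ≡ u → Covered h g

  bad? : ∀ u h → Dec (Bad u h)
  bad? u h = all? (λ g → (σ g ≟ u) →-dec covered? h g)

  ¬Bad⇒uncovered : ∀ {u h} → ¬ Bad u h → ∃ λ g → σ g ≡ u × ¬ Covered h g
  ¬Bad⇒uncovered {u} {h} ¬bad with ¬∀⟶∃¬ (n G) _ (λ g → (σ g ≟ u) →-dec covered? h g) ¬bad
  ... | g , ¬[σg≡u⇒cov] with σ g ≟ u
  ...   | yes σg≡u = g , σg≡u , λ cov → ¬[σg≡u⇒cov] (λ _ → cov)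
  ...   | no  σg≢u = contradiction (λ σg≡u → contradiction σg≡u σg≢u) ¬[σg≡u⇒cov]

  -- projection u is the f_u above; it is defined for every u but only used for u ∈ D.
  projection : Fin (n G) → Fin (n H) → Fin 3
  projection u h with inCell? isTwo u h
  ... | yes _ = 2F
  ... | no  _ with inCell? isPositive u h ⊎-dec bad? u h
  ...   | yes _ = 1F
  ...   | no  _ = 0F

  projection-two : ∀ {u h} → InCell isTwo u h → projection u h ≡ 2F
  projection-two {u} {h} two with inCell? isTwo u h
  ... | yes _   = refl
  ... | no ¬two = contradiction two ¬two

  projection-isRDF : ∀ u → IsRDF H (projection u)
  projection-isRDF u h proj≡0 with inCell? isTwo u h
  projection-isRDF u h () | yes _
  ... | no _ with inCell? isPositive u h ⊎-dec bad? u h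
  projection-isRDF u h () | no _ | yes _
  ... | no ¬pos⊎bad with ¬Bad⇒uncovered (¬pos⊎bad ∘ inj₂)
  ...   | g , σg≡u , ¬cov
    with φ-rdf g h (isPositive≡false⇒0F (¬-not (λ pos → ¬pos⊎bad (inj₁ (g , σg≡u , pos)))))
  ...     | inj₁ (h′ , h∼h′ , φ≡2) = h′ , h∼h′ , projection-two (g , σg≡u , cong isTwo φ≡2)
  ...     | inj₂ (g′ , g∼g′ , φ≡2) = contradiction (g′ , g∼g′ , φ≡2) ¬cov

  cellSum : Fin (n G) → Fin (n H) → ℕ
  cellSum u h = ∑[ g < n G ] (bit (does (σ g ≟ u)) * toℕ (φ g h))

  cell-term≤cellSum : ∀ {g u} h → σ g ≡ u → toℕ (φ g h) ≤ cellSum u h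
  cell-term≤cellSum {g} {u} h σg≡u = begin
    toℕ (φ g h)                        ≡⟨ sym (+-identityʳ _) ⟩
    bit true * toℕ (φ g h)             ≡⟨ cong (λ b → bit b * toℕ (φ g h)) (sym (dec-true (σ g ≟ u) σg≡u)) ⟩
    bit (does (σ g ≟ u)) * toℕ (φ g h) ≤⟨ term≤∑ (λ g → bit (does (σ g ≟ u)) * toℕ (φ g h)) g ⟩
    cellSum u h                        ∎
    where open ≤-Reasoning

  toℕ-projection≤ : ∀ u h → toℕ (projection u h) ≤ cellSum u h + bit (does (bad? u h))
  toℕ-projection≤ u h with inCell? isTwo u h
  ... | yes (g , σg≡u , two) =
    ≤-trans (subst (λ x → toℕ x ≤ cellSum u h) (isTwo≡true⇒2F two) (cell-term≤cellSum h σg≡u)) (m≤m+n _ _)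
  ... | no _ with inCell? isPositive u h ⊎-dec bad? u h
  ...   | yes (inj₁ (g , σg≡u , pos)) =
    ≤-trans (≤-trans (isPositive≡true⇒1≤toℕ pos) (cell-term≤cellSum h σg≡u)) (m≤m+n _ _)
  ...   | yes (inj₂ bad) = ≤-trans (≤-reflexive (cong bit (sym (dec-true (bad? u h) bad)))) (m≤n+m _ _)
  ...   | no _ = z≤n

  repair : Fin (n H) → VSet G
  repair h v = (D v ∧ not (does (bad? v h))) ∨ isTwo (φ v h)

  D∖Bad⊆repair : ∀ {u h} → D u ≡ true → ¬ Bad u h → repair h u ≡ true
  D∖Bad⊆repair {u} {h} u∈D ¬bad =
    cong₂ (λ a b → (a ∧ not b) ∨ isTwo (φ u h)) u∈D (dec-false (bad? u h) ¬bad)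

  V₂⊆repair : ∀ {g h} → φ g h ≡ 2F → repair h g ≡ true
  V₂⊆repair φ≡2 rewrite φ≡2 = ∨-zeroʳ _

  repair-dominating : ∀ h → IsDominating G (repair h)
  repair-dominating h v v∉repair with bad? (σ v) h
  ... | yes bad = let (g′ , v∼g′ , φ≡2) = bad v refl in g′ , v∼g′ , V₂⊆repair φ≡2
  ... | no ¬bad with proj₂ (proj₂ (dominator {G} D-dom v))
  ...   | inj₂ v∼σv = σ v , v∼σv , D∖Bad⊆repair (σ∈D v) ¬bad
  ...   | inj₁ v≡σv =
    contradiction (trans (sym v∉repair) (trans (cong (repair h) v≡σv) (D∖Bad⊆repair (σ∈D v) ¬bad))) λ ()

  ∑-layers≡weight+|V₂| : ∑[ h < n H ] ∑[ g < n G ] (toℕ (φ g h) + bit (isTwo (φ g h)))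
                        ≡ weight (G □ H) f + size (G □ H) (V₂ f)
  ∑-layers≡weight+|V₂| = begin
    ∑[ h < n H ] ∑[ g < n G ] (toℕ (φ g h) + bit (isTwo (φ g h)))
      ≡⟨ ∑-comm (λ h g → toℕ (φ g h) + bit (isTwo (φ g h))) ⟩
    ∑[ g < n G ] ∑[ h < n H ] (toℕ (φ g h) + bit (isTwo (φ g h)))
      ≡⟨ sym (∑-combine (n G) (n H) (λ k → toℕ (f k) + bit (isTwo (f k)))) ⟩
    ∑[ k < n G * n H ] (toℕ (f k) + bit (isTwo (f k)))
      ≡⟨ ∑-distrib-+ (toℕ ∘ f) (bit ∘ V₂ f) ⟩
    sum (toℕ ∘ f) + sum (bit ∘ V₂ f)
      ≡⟨ sym (cong₂ _+_ (sumFin≡sum (toℕ ∘ f)) (sumFin≡sum (bit ∘ V₂ f))) ⟩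
    weight (G □ H) f + size (G □ H) (V₂ f) ∎
    where open ≡-Reasoning

  module _ (D-min : ∀ D′ → IsDominating G D′ → size G D ≤ size G D′) where

    layer-bound : ∀ h → ∑[ u < n G ] (bit (D u) * toℕ (projection u h))
                        ≤ ∑[ g < n G ] (toℕ (φ g h) + bit (isTwo (φ g h)))
    layer-bound h = begin
      ∑[ u < n G ] (bit (D u) * toℕ (projection u h))
        ≤⟨ ∑-mono-≤ D-weighted-bound ⟩
      ∑[ u < n G ] (cellSum u h + bit (D u ∧ does (bad? u h)))
        ≡⟨ ∑-distrib-+ (λ u → cellSum u h) (λ u → bit (D u ∧ does (bad? u h))) ⟩
      ∑[ u < n G ] cellSum u h + ∑[ u < n G ] bit (D u ∧ does (bad? u h))
        ≤⟨ +-mono-≤ (≤-reflexive (∑-fibres σ (λ g → toℕ (φ g h)))) |D∩Bad|≤|V₂| ⟩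
      ∑[ g < n G ] toℕ (φ g h) + ∑[ g < n G ] bit (isTwo (φ g h))
        ≡⟨ sym (∑-distrib-+ (λ g → toℕ (φ g h)) (λ g → bit (isTwo (φ g h)))) ⟩
      ∑[ g < n G ] (toℕ (φ g h) + bit (isTwo (φ g h))) ∎
      where
      open ≤-Reasoning
      D-weighted-bound : ∀ u → bit (D u) * toℕ (projection u h) ≤ cellSum u h + bit (D u ∧ does (bad? u h))
      D-weighted-bound u with D u
      ... | true  = ≤-trans (≤-reflexive (+-identityʳ _)) (toℕ-projection≤ u h)
      ... | false = z≤n
      |D∩Bad|≤|V₂| : ∑[ u < n G ] bit (D u ∧ does (bad? u h)) ≤ ∑[ g < n G ] bit (isTwo (φ g h))
      |D∩Bad|≤|V₂| = subst₂ _≤_ (sumFin≡sum (λ u → bit (D u ∧ does (bad? u h))))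
                                (sumFin≡sum (λ g → bit (isTwo (φ g h))))
        (minimum-dominating-exchange G D-min (λ u → does (bad? u h)) (λ g → isTwo (φ g h)) (repair-dominating h))

    |D|*γR≤weight+|V₂| : ∀ {b} → (∀ f′ → IsRDF H f′ → b ≤ weight H f′) →
                         size G D * b ≤ weight (G □ H) f + size (G □ H) (V₂ f)
    |D|*γR≤weight+|V₂| {b} b-min = begin
      size G D * b
        ≡⟨ cong (_* b) (sumFin≡sum (bit ∘ D)) ⟩
      sum (bit ∘ D) * b
        ≡⟨ *-distribʳ-sum b (bit ∘ D) ⟩
      ∑[ u < n G ] (bit (D u) * b)
        ≤⟨ ∑-mono-≤ (λ u → *-monoʳ-≤ (bit (D u)) (b-min (projection u) (projection-isRDF u))) ⟩
      ∑[ u < n G ] (bit (D u) * weight H (projection u))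
        ≡⟨ sum-cong-≗ (λ u → trans (cong (bit (D u) *_) (sumFin≡sum (toℕ ∘ projection u)))
                                  (*-distribˡ-sum (bit (D u)) (toℕ ∘ projection u))) ⟩
      ∑[ u < n G ] ∑[ h < n H ] (bit (D u) * toℕ (projection u h))
        ≡⟨ ∑-comm (λ u h → bit (D u) * toℕ (projection u h)) ⟩
      ∑[ h < n H ] ∑[ u < n G ] (bit (D u) * toℕ (projection u h))
        ≤⟨ ∑-mono-≤ layer-bound ⟩
      ∑[ h < n H ] ∑[ g < n G ] (toℕ (φ g h) + bit (isTwo (φ g h)))
        ≡⟨ ∑-layers≡weight+|V₂| ⟩
      weight (G □ H) f + size (G □ H) (V₂ f) ∎
      where open ≤-Reasoning

m≤n+o⇒o+o≤n⇒2m≤3n : ∀ {m n o} → m ≤ n + o → o + o ≤ n → 2 * m ≤ 3 * n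
m≤n+o⇒o+o≤n⇒2m≤3n {m} {n} {o} m≤n+o o+o≤n = begin
  2 * m           ≤⟨ *-monoʳ-≤ 2 m≤n+o ⟩
  2 * (n + o)     ≡⟨ solve (n ∷ o ∷ []) ⟩
  n + n + (o + o) ≤⟨ +-monoʳ-≤ (n + n) o+o≤n ⟩
  n + n + n       ≡⟨ solve (n ∷ []) ⟩
  3 * n           ∎
  where open ≤-Reasoning

m≤n+o⇒p+o≤n⇒m+p≤2n : ∀ {m n o p} → m ≤ n + o → p + o ≤ n → m + p ≤ 2 * n
m≤n+o⇒p+o≤n⇒m+p≤2n {m} {n} {o} {p} m≤n+o p+o≤n = begin
  m + p       ≤⟨ +-monoˡ-≤ p m≤n+o ⟩
  n + o + p   ≡⟨ solve (n ∷ o ∷ p ∷ []) ⟩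
  n + (p + o) ≤⟨ +-monoʳ-≤ n p+o≤n ⟩
  n + n       ≡⟨ solve (n ∷ []) ⟩
  2 * n       ∎
  where open ≤-Reasoning

|V₂|+|V₂|≤weight : ∀ G f → size G (V₂ f) + size G (V₂ f) ≤ weight G f
|V₂|+|V₂|≤weight G f =
  ≤-trans (+-monoˡ-≤ _ (|V₂|≤|V₁₂| G f)) (≤-reflexive (sym (weight≡|V₁₂|+|V₂| G f)))

γ+|V₂|≤weight : ∀ G {f d} → IsRDF G f → (∀ D → IsDominating G D → d ≤ size G D) →
                d + size G (V₂ f) ≤ weight G f
γ+|V₂|≤weight G {f} f-rdf d-min =
  ≤-trans (+-monoˡ-≤ _ (d-min _ (V₁₂-dominating {G} f-rdf))) (≤-reflexive (sym (weight≡|V₁₂|+|V₂| G f)))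

theorem3 : (G H : Graph) (a b c d : ℕ) →
    IsDominationNumber G a → IsRomanDominationNumber H b →
    IsRomanDominationNumber (G □ H) c → IsDominationNumber (G □ H) d →
    (2 * (a * b) ≤ 3 * c) × (a * b + d ≤ 2 * c)
theorem3 G H _ b _ d ((D , D-dom , refl) , D-min) (_ , b-min) ((f , f-rdf , refl) , _) (_ , d-min) =
  m≤n+o⇒o+o≤n⇒2m≤3n γγR≤w+t t+t≤w , m≤n+o⇒p+o≤n⇒m+p≤2n γγR≤w+t d+t≤w
  where
  open CellProjection G H f-rdf D-dom
  t : ℕ
  t = size (G □ H) (V₂ f)
  γγR≤w+t : size G D * b ≤ weight (G □ H) f + t
  γγR≤w+t = |D|*γR≤weight+|V₂| D-min b-min
  t+t≤w : t + t ≤ weight (G □ H) f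
  t+t≤w = |V₂|+|V₂|≤weight (G □ H) f
  d+t≤w : d + t ≤ weight (G □ H) f
  d+t≤w = γ+|V₂|≤weight (G □ H) f-rdf d-min
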